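{- For every complete 8-partite graph $K$ (with arbitrary finite part sizes) there is a finite generic set $Y\subset\mathbb{R}^3$ such that $K$ is isomorphic to a subgraph of the box graph $G_b(Y)$.
   Context: A finite set $Y\subset\mathbb{R}^3$ is generic if no two of its points share a coordinate. For $p,q\in Y$, $B[p,q]$ is the smallest closed axis-aligned box containing $p$ and $q$. The box graph $G_b(Y)$ has vertex set $Y$, and $p,q$ are adjacent iff the open interior of $B[p,q]$ contains no point of $Y$. -}

module Defs where

open import Data.Nat using (ℕ; _<_)
open import Data.Fin using (Fin)
open import Data.Product using (Σ; _×_; ∃-syntax)
open import Data.Sum using (_⊎_)
open import Relation.Nullary using (¬_)
open import Relation.Binary.PropositionalEquality using (_≡_)
open import Function.Definitions using (Injective)

-- A point of "R^3" (coordinates in ℕ ⊂ ℝ suffice, only the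
-- coordinate order matters).
Point : Set
Point = Fin 3 → ℕ

Generic : {m : ℕ} → (Fin m → Point) → Set
Generic {m} Y = ∀ (a b : Fin m) → ¬ (a ≡ b) → ∀ (k : Fin 3) → ¬ (Y a k ≡ Y b k)

StrictlyBetween : ℕ → ℕ → ℕ → Set
StrictlyBetween x y z = (x < z × z < y) ⊎ (y < z × z < x)

InOpenBox : Point → Point → Point → Set
InOpenBox p q r = ∀ (k : Fin 3) → StrictlyBetween (p k) (q k) (r k)

BoxAdj : {m : ℕ} → (Fin m → Point) → Fin m → Fin m → Set
BoxAdj {m} Y a b = ¬ (a ≡ b) × (∀ (c : Fin m) → ¬ InOpenBox (Y a) (Y b) (Y c))

KVertex : (Fin 8 → ℕ) → Set
KVertex sz = Σ (Fin 8) (λ i → Fin (sz i))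

KAdj : (sz : Fin 8 → ℕ) → KVertex sz → KVertex sz → Set
KAdj sz u v = ¬ (Σ.proj₁ u ≡ Σ.proj₁ v)

SubgraphOfBox : (sz : Fin 8 → ℕ) → {m : ℕ} → (Fin m → Point) → Set
SubgraphOfBox sz {m} Y =
  Σ (KVertex sz → Fin m) λ f →
    Injective _≡_ _≡_ f × (∀ u v → KAdj sz u v → BoxAdj Y (f u) (f v))

{-# OPTIONS --safe #-}
module Submission where

-- Start from eight generic points of the grid {0,…,7}³ whose box graph is K₈ and replace
-- the i-th of them by a tiny chain of N points (t = 0,…,N-1), increasing or decreasing in
-- each coordinate according to a sign pattern.  For an edge between (i,t) and (j,u), i ≢ j,
-- a point of a third cluster is outside the box because its centre is outside the box of
-- the centres.  A point (i,w) of the same cluster inside the box must, in every coordinate,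
-- lie beyond (i,t) in the direction of centre j; in the chain parameter this reads t < w or
-- w < t according to the orientation of cluster i toward j in that coordinate, and the
-- sign pattern makes both orientations occur for every ordered pair i ≢ j.

open import Defs
import Data.Nat.Properties as ℕ
open import Algebra.Properties.CommutativeMonoid.Sum ℕ.+-0-commutativeMonoid
  using (sum; sum-remove)
open import Data.Bool using (Bool; true; false; _xor_)
import Data.Bool.Properties as Bool
open import Data.Fin
  using (Fin; zero; suc; toℕ; combine; remQuot; opposite; inject≤; _<_; _≤_; #_)
open import Data.Fin.Properties
  using ( toℕ-injective; toℕ<n; toℕ-combine; combine-monoˡ-<; combine-injective
        ; combine-injectiveˡ; combine-remQuot; remQuot-combine; inject≤-injective
        ; opposite-prop; opposite-involutive; ≤∧≢⇒<; _≟_; _<?_; all?; any?)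
open import Data.Nat as ℕ using (ℕ; _≤ᵇ_)
open import Data.Product using (Σ; _×_; _,_; ∃₂; uncurry)
open import Data.Sum as Sum using (inj₁; inj₂)
open import Data.Vec using (_∷_; []; lookup)
open import Function using (_∘_)
open import Function.Definitions using (Injective)
open import Relation.Binary.PropositionalEquality
open import Relation.Nullary using (¬_; Dec; does; yes; no; contradiction)
open import Relation.Nullary.Decidable using (_×-dec_; _⊎-dec_; _→-dec_; ¬?; from-yes)

module _ {N : ℕ} where

  opposite-anti-< : {t w : Fin N} → t < w → opposite w < opposite t
  opposite-anti-< {t} {w} t<w =
    subst₂ ℕ._<_ (sym (opposite-prop w)) (sym (opposite-prop t))
      (ℕ.∸-monoʳ-< (ℕ.s≤s t<w) (toℕ<n w))

  opposite-cancel-< : {t w : Fin N} → opposite t < opposite w → w < t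
  opposite-cancel-< {t} {w} lt =
    subst₂ _<_ (opposite-involutive w) (opposite-involutive t) (opposite-anti-< lt)

  flipIf : Bool → Fin N → Fin N
  flipIf false t = t
  flipIf true  t = opposite t

  flipIf-injective : ∀ f {t w : Fin N} → flipIf f t ≡ flipIf f w → t ≡ w
  flipIf-injective false e = e
  flipIf-injective true {t} {w} e = begin
    t                     ≡⟨ opposite-involutive t ⟨
    opposite (opposite t) ≡⟨ cong opposite e ⟩
    opposite (opposite w) ≡⟨ opposite-involutive w ⟩
    w                     ∎
    where open ≡-Reasoning

  Beyond : Bool → Fin N → Fin N → Set
  Beyond true  t w = t < w
  Beyond false t w = w < t

  Beyond-flipIf : ∀ f up {t w : Fin N} →
                  Beyond up (flipIf f t) (flipIf f w) → Beyond (f xor up) t w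
  Beyond-flipIf false up    b = b
  Beyond-flipIf true  true  b = opposite-cancel-< b
  Beyond-flipIf true  false b = opposite-cancel-< b

  Beyond-unique : ∀ {up up′} {t w : Fin N} → Beyond up t w → Beyond up′ t w → up ≡ up′
  Beyond-unique {true}  {true}  _   _   = refl
  Beyond-unique {true}  {false} t<w w<t = contradiction w<t (ℕ.<-asym t<w)
  Beyond-unique {false} {true}  w<t t<w = contradiction w<t (ℕ.<-asym t<w)
  Beyond-unique {false} {false} _   _   = refl

module _ {M N : ℕ} where

  combine-cancelˡ-< : ∀ (a : Fin M) {x z : Fin N} → combine a x < combine a z → x < z
  combine-cancelˡ-< a {x} {z} lt = ℕ.+-cancelˡ-< (N ℕ.* toℕ a) (toℕ x) (toℕ z)
    (subst₂ ℕ._<_ (toℕ-combine a x) (toℕ-combine a z) lt)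

  combine-<⇒≤ˡ : {a c : Fin M} {x z : Fin N} → combine a x < combine c z → a ≤ c
  combine-<⇒≤ˡ {x = x} {z} lt = ℕ.≮⇒≥ λ c<a → ℕ.<-asym lt (combine-monoˡ-< z x c<a)

  combine-between⇒between : {a b c : Fin M} {x y z : Fin N} → c ≢ a → c ≢ b →
    StrictlyBetween (toℕ (combine a x)) (toℕ (combine b y)) (toℕ (combine c z)) →
    StrictlyBetween (toℕ a) (toℕ b) (toℕ c)
  combine-between⇒between c≢a c≢b (inj₁ (l , r)) =
    inj₁ (≤∧≢⇒< (combine-<⇒≤ˡ l) (≢-sym c≢a) , ≤∧≢⇒< (combine-<⇒≤ˡ r) c≢b)
  combine-between⇒between c≢a c≢b (inj₂ (l , r)) =
    inj₂ (≤∧≢⇒< (combine-<⇒≤ˡ l) (≢-sym c≢b) , ≤∧≢⇒< (combine-<⇒≤ˡ r) c≢a)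

  combine-between⇒Beyond : {a b : Fin M} {x y z : Fin N} → a ≢ b →
    StrictlyBetween (toℕ (combine a x)) (toℕ (combine b y)) (toℕ (combine a z)) →
    Beyond (does (a <? b)) x z
  combine-between⇒Beyond {a} {b} {x} {y} {z} a≢b = by-cases (a <? b)
    where
    by-cases : (a<?b : Dec (a < b)) →
      StrictlyBetween (toℕ (combine a x)) (toℕ (combine b y)) (toℕ (combine a z)) →
      Beyond (does a<?b) x z
    by-cases (yes _)   (inj₁ (x<z , _))  = combine-cancelˡ-< a x<z
    by-cases (yes a<b) (inj₂ (by<az , _)) = contradiction (combine-<⇒≤ˡ by<az) (ℕ.<⇒≱ a<b)
    by-cases (no a≮b)  (inj₁ (_ , az<by)) = contradiction (≤∧≢⇒< (combine-<⇒≤ˡ az<by) a≢b) a≮b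
    by-cases (no _)    (inj₂ (_ , z<x))  = combine-cancelˡ-< a z<x

  remQuot-injective : {p q : Fin (M ℕ.* N)} → remQuot {M} N p ≡ remQuot N q → p ≡ q
  remQuot-injective {p} {q} e = begin
    p                                 ≡⟨ combine-remQuot {M} N p ⟨
    uncurry combine (remQuot {M} N p) ≡⟨ cong (uncurry combine) e ⟩
    uncurry combine (remQuot {M} N q) ≡⟨ combine-remQuot {M} N q ⟩
    q                                 ∎
    where open ≡-Reasoning

InOpenBox-sym : ∀ {p q r} → InOpenBox p q r → InOpenBox q p r
InOpenBox-sym box k = Sum.swap (box k)

BoxGraphComplete : ∀ {m} → (Fin m → Point) → Set
BoxGraphComplete Y = ∀ a b → a ≢ b → BoxAdj Y a b

strictlyBetween? : ∀ x y z → Dec (StrictlyBetween x y z)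
strictlyBetween? x y z = (x ℕ.<? z ×-dec z ℕ.<? y) ⊎-dec (y ℕ.<? z ×-dec z ℕ.<? x)

inOpenBox? : ∀ p q r → Dec (InOpenBox p q r)
inOpenBox? p q r = all? λ k → strictlyBetween? (p k) (q k) (r k)

boxAdj? : ∀ {m} (Y : Fin m → Point) a b → Dec (BoxAdj Y a b)
boxAdj? Y a b = ¬? (a ≟ b) ×-dec all? λ c → ¬? (inOpenBox? (Y a) (Y b) (Y c))

boxGraphComplete? : ∀ {m} (Y : Fin m → Point) → Dec (BoxGraphComplete Y)
boxGraphComplete? Y = all? λ a → all? λ b → ¬? (a ≟ b) →-dec boxAdj? Y a b

generic? : ∀ {m} (Y : Fin m → Point) → Dec (Generic Y)
generic? Y = all? λ a → all? λ b → ¬? (a ≟ b) →-dec all? λ k → ¬? (Y a k ℕ.≟ Y b k)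

module Clusters {n M : ℕ} (centre : Fin n → Fin 3 → Fin M)
                (reversed : Fin n → Fin 3 → Bool) where

  centrePoint : Fin n → Point
  centrePoint i k = toℕ (centre i k)

  -- true iff, in coordinate k, moving from cluster i toward centre j increases the chain
  -- parameter t.
  orientation : Fin n → Fin n → Fin 3 → Bool
  orientation i j k = reversed i k xor does (centre i k <? centre j k)

  MixedOrientation : Set
  MixedOrientation = ∀ i j → i ≢ j → ∃₂ λ k k′ → orientation i j k ≢ orientation i j k′

  -- Coordinate k of the t-th point of cluster i is N · centre i k + offset, so every cluster
  -- occupies its own block of N consecutive values in each coordinate.
  blowUp : (N : ℕ) → Fin n × Fin N → Point
  blowUp N (i , t) k = toℕ (combine (centre i k) (flipIf (reversed i k) t))

  blowUpSet : (N : ℕ) → Fin (n ℕ.* N) → Point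
  blowUpSet N = blowUp N ∘ remQuot N

  blowUpSet-combine : ∀ {N} i (t : Fin N) → blowUpSet N (combine i t) ≡ blowUp N (i , t)
  blowUpSet-combine i t = cong (blowUp _) (remQuot-combine i t)

  module _ (centres-generic : Generic centrePoint) {N : ℕ} where

    centre-≢ : ∀ {i j} → i ≢ j → ∀ k → centre i k ≢ centre j k
    centre-≢ i≢j k = centres-generic _ _ i≢j k ∘ cong toℕ

    blowUp-injectiveAt : ∀ k {x y : Fin n × Fin N} → blowUp N x k ≡ blowUp N y k → x ≡ y
    blowUp-injectiveAt k {i , t} {j , u} e
      with centreᵢ≡centreⱼ , offsetᵢ≡offsetⱼ ← combine-injective _ _ _ _ (toℕ-injective e)
      with i ≟ j
    ... | no i≢j  = contradiction centreᵢ≡centreⱼ (centre-≢ i≢j k)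
    ... | yes refl = cong (i ,_) (flipIf-injective (reversed i k) offsetᵢ≡offsetⱼ)

    blowUpSet-generic : Generic (blowUpSet N)
    blowUpSet-generic a b a≢b k = a≢b ∘ remQuot-injective ∘ blowUp-injectiveAt k

    blowUp-otherCluster : ∀ {i j l} → BoxAdj centrePoint i j → l ≢ i → l ≢ j →
      ∀ t u w → ¬ InOpenBox (blowUp N (i , t)) (blowUp N (j , u)) (blowUp N (l , w))
    blowUp-otherCluster {l = l} (_ , centre-unblocked) l≢i l≢j t u w box =
      centre-unblocked l λ k →
        combine-between⇒between (centre-≢ l≢i k) (centre-≢ l≢j k) (box k)

    blowUp-ownCluster : ∀ {i j} → i ≢ j → ∃₂ (λ k k′ → orientation i j k ≢ orientation i j k′) →
      ∀ t u w → ¬ InOpenBox (blowUp N (i , t)) (blowUp N (j , u)) (blowUp N (i , w))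
    blowUp-ownCluster {i} {j} i≢j (k , k′ , mixed) t u w box =
      mixed (Beyond-unique (beyond k) (beyond k′))
      where
      beyond : ∀ k → Beyond (orientation i j k) t w
      beyond k = Beyond-flipIf (reversed i k) _ (combine-between⇒Beyond (centre-≢ i≢j k) (box k))

    module _ (centres-complete : BoxGraphComplete centrePoint)
             (orientation-mixed : MixedOrientation) where

      blowUp-unblocked : ∀ {i j} → i ≢ j →
        ∀ t u x → ¬ InOpenBox (blowUp N (i , t)) (blowUp N (j , u)) (blowUp N x)
      blowUp-unblocked {i} {j} i≢j t u (l , w) with l ≟ i | l ≟ j
      ... | yes refl | _        = blowUp-ownCluster i≢j (orientation-mixed i j i≢j) t u w
      ... | _        | yes refl =
        blowUp-ownCluster (≢-sym i≢j) (orientation-mixed j i (≢-sym i≢j)) u t w ∘ InOpenBox-sym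
      ... | no l≢i   | no l≢j   =
        blowUp-otherCluster (centres-complete i j i≢j) l≢i l≢j t u w

      blowUpSet-boxAdj : ∀ {i j} → i ≢ j → ∀ t u → BoxAdj (blowUpSet N) (combine i t) (combine j u)
      blowUpSet-boxAdj {i} {j} i≢j t u = i≢j ∘ combine-injectiveˡ i t j u , λ c →
        subst₂ (λ p q → ¬ InOpenBox p q (blowUpSet N c))
          (sym (blowUpSet-combine i t)) (sym (blowUpSet-combine j u))
          (blowUp-unblocked i≢j t u (remQuot N c))

K₈-centre : Fin 8 → Fin 3 → Fin 8
K₈-centre i zero             = i
K₈-centre i (suc zero)       = lookup (# 5 ∷ # 2 ∷ # 1 ∷ # 0 ∷ # 6 ∷ # 3 ∷ # 7 ∷ # 4 ∷ []) i
K₈-centre i (suc (suc zero)) = lookup (# 6 ∷ # 4 ∷ # 7 ∷ # 5 ∷ # 2 ∷ # 0 ∷ # 3 ∷ # 1 ∷ []) i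

K₈-reversed : Fin 8 → Fin 3 → Bool
K₈-reversed i (suc zero) = 4 ≤ᵇ toℕ i
K₈-reversed _ _          = false

open Clusters K₈-centre K₈-reversed

K₈-generic : Generic centrePoint
K₈-generic = from-yes (generic? centrePoint)

K₈-complete : BoxGraphComplete centrePoint
K₈-complete = from-yes (boxGraphComplete? centrePoint)

K₈-mixed : MixedOrientation
K₈-mixed = from-yes (all? λ i → all? λ j → ¬? (i ≟ j) →-dec
  any? λ k → any? λ k′ → ¬? (orientation i j k Bool.≟ orientation i j k′))

K₈-blowUp-subgraph : ∀ sz {N} → (∀ i → sz i ℕ.≤ N) → SubgraphOfBox sz (blowUpSet N)
K₈-blowUp-subgraph sz {N} sz≤N = embed , embed-injective , embed-adjacent
  where
  embed : KVertex sz → Fin (8 ℕ.* N)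
  embed (i , t) = combine i (inject≤ t (sz≤N i))

  embed-injective : Injective _≡_ _≡_ embed
  embed-injective {i , t} {j , u} e with refl , e′ ← combine-injective i _ j _ e =
    cong (i ,_) (inject≤-injective _ _ t u e′)

  embed-adjacent : ∀ u v → KAdj sz u v → BoxAdj (blowUpSet N) (embed u) (embed v)
  embed-adjacent (i , t) (j , u) i≢j =
    blowUpSet-boxAdj K₈-generic K₈-complete K₈-mixed i≢j _ _

proposition9 : (sz : Fin 8 → ℕ) →
    Σ ℕ λ m → Σ (Fin m → Point) λ Y → Generic Y × SubgraphOfBox sz Y
proposition9 sz =
  8 ℕ.* sum sz , blowUpSet (sum sz) , blowUpSet-generic K₈-generic ,
  K₈-blowUp-subgraph sz part≤sum
  where
  part≤sum : ∀ i → sz i ℕ.≤ sum sz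
  part≤sum i = subst (sz i ℕ.≤_) (sym (sum-remove {i = i} sz)) (ℕ.m≤m+n (sz i) _)
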